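{- Let $G=(V,E)$ be a simple connected graph with $n=|V|$, and let $\{V_1,V_2,V_3,V_4\}$ be a feasible tetrapartition of $V$ with $|V_1|\le|V_2|\le|V_3|\le|V_4|$ and $|V_4|>\frac25 n$, to which no Merge and no Pull operation is applicable, and such that $|V_2|+|V_3|\ge|V_4|$, $|V_4|<\frac12 n$, $|V_1|\le|V_2|<\frac16|V_4|<\frac1{12}n$, and $|V_3|>\frac13 n$. Suppose we are in Case 1: neither $V_1$ nor $V_2$ is adjacent to $V_3$, and both $V_1$ and $V_2$ are adjacent to $V_4$ only at a single vertex $u\in V_4$ (i.e. every edge between $V_1\cup V_2$ and $V_3\cup V_4$ has $u$ as its endpoint in $V_3\cup V_4$). Let $V'_4$ be the union of the vertex sets of all connected components of $G[V_4\setminus\{u\}]$ that are adjacent to $V_3$. If $|V'_4|\le|V_1|+|V_2|+\frac{11}{24}|V_4|$, then $|V_4|\le\frac{24}{13}\,\mathrm{OPT}$.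
   Context: A feasible tetrapartition of $V$ is a partition into four non-empty parts each inducing a connected subgraph of $G$; $\mathrm{OPT}$ is the minimum, over all feasible tetrapartitions, of the largest part size. Two disjoint vertex sets are adjacent if some edge joins them. For a sorted feasible tetrapartition with $|V_4|>\frac25 n$: a Merge operation is applicable if there are distinct $i,j\in\{1,2,3\}$ with $V_i,V_j$ adjacent and $|V_i|+|V_j|<|V_4|$; a Pull operation is applicable if no Merge is applicable and there exist $(i,j)\in\{(1,3),(1,4),(2,3),(2,4),(3,4)\}$ and a non-empty proper subset $U\subset V_j$ with $G[U]$ and $G[V_j\setminus U]$ connected, $U$ adjacent to $V_i$, and $|V_i|+|U|<|V_j|$. -}

module Defs where

open import Data.Nat using (ℕ; _+_; _⊔_)
open import Data.Fin using (Fin)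
open import Data.Fin.Subset using (Subset; _∈_; _∪_; _─_; ⁅_⁆; ∣_∣; Nonempty)
open import Data.Product using (Σ; ∃; _×_; _,_)
open import Data.Sum using (_⊎_)
open import Data.Empty using (⊥)
open import Relation.Nullary using (¬_)
open import Relation.Binary.PropositionalEquality using (_≡_)

record SimpleGraph (n : ℕ) : Set₁ where
  field
    E      : Fin n → Fin n → Set
    sym    : ∀ {x y} → E x y → E y x
    irrefl : ∀ {x} → ¬ E x x
open SimpleGraph public

module _ {n : ℕ} (G : SimpleGraph n) where

  data Reach (S : Subset n) : Fin n → Fin n → Set where
    here : ∀ {x} → x ∈ S → Reach S x x
    step : ∀ {x y z} → x ∈ S → E G x y → Reach S y z → Reach S x z

  Connected : Subset n → Set
  Connected S = ∀ x y → x ∈ S → y ∈ S → Reach S x y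

  ConnectedGraph : Set
  ConnectedGraph = ∀ x y → Reach (Data.Fin.Subset.⊤) x y

  Adjacent : Subset n → Subset n → Set
  Adjacent A B = ∃ λ x → ∃ λ y → x ∈ A × y ∈ B × E G x y

  Disjoint : Subset n → Subset n → Set
  Disjoint A B = ∀ x → x ∈ A → x ∈ B → ⊥

  FeasibleTetra : Subset n → Subset n → Subset n → Subset n → Set
  FeasibleTetra A B C D =
    (Nonempty A × Nonempty B × Nonempty C × Nonempty D) ×
    (Connected A × Connected B × Connected C × Connected D) ×
    (Disjoint A B × Disjoint A C × Disjoint A D ×
     Disjoint B C × Disjoint B D × Disjoint C D) ×
    (∀ x → x ∈ A ⊎ x ∈ B ⊎ x ∈ C ⊎ x ∈ D)

  maxPart : Subset n → Subset n → Subset n → Subset n → ℕ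
  maxPart A B C D = ∣ A ∣ ⊔ ∣ B ∣ ⊔ ∣ C ∣ ⊔ ∣ D ∣

  IsOPT : ℕ → Set
  IsOPT k =
    (∃ λ A → ∃ λ B → ∃ λ C → ∃ λ D → FeasibleTetra A B C D × maxPart A B C D ≡ k) ×
    (∀ A B C D → FeasibleTetra A B C D → k Data.Nat.≤ maxPart A B C D)

  MergeOn : Subset n → Subset n → Subset n → Set
  MergeOn Vi Vj V4 = Adjacent Vi Vj × (∣ Vi ∣ + ∣ Vj ∣) Data.Nat.< ∣ V4 ∣

  PullOn : Subset n → Subset n → Set
  PullOn Vi Vj = ∃ λ U →
    (∀ x → x ∈ U → x ∈ Vj) × Nonempty U × Nonempty (Vj ─ U) ×
    Connected U × Connected (Vj ─ U) × Adjacent U Vi ×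
    (∣ Vi ∣ + ∣ U ∣) Data.Nat.< ∣ Vj ∣

module Submission where

-- Suppose OPT = k with 24k < 13|V₄| and fix an optimal tetrapartition.
-- Each of its parts Q not containing u is connected and avoids u, and since every
-- edge leaving V₁ ∪ V₂ ends at u, such a Q is trapped in one region of G - u:
--   * inside V₁ ∪ V₂, so |Q| ≤ |V₁| + |V₂|;
--   * inside V₃ ∪ W (W = V'₄), because V₃ ∪ W is closed under edges avoiding u;
--   * inside a component C of G[V₄ - u] not adjacent to V₃; then |C| ≤ |V₂|, since
--     otherwise Pull could move V₄ - C, which contains the neighbour u of V₁ ∪ V₂,
--     into V₁ or V₂.
-- If some such Q is of the first or third kind, the four parts cover V with total size
-- at most 3k + |V₁| + |V₂|, so |V₃| + |V₄| ≤ 3k, contradicting |V₃| > 2|V₄|/3.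
-- Otherwise V₁ ∪ V₂ ∪ V₄ lies in the part containing u together with W, and the
-- assumed bound on |W| gives 13|V₄| ≤ 24k.

open import Defs
open import Data.Nat using (ℕ; zero; suc; _+_; _*_; _≤_; _<_; _≤?_; _⊔_; z≤n; s≤s)
open import Data.Nat.Properties hiding (_≟_)
open import Data.Nat.Tactic.RingSolver using (solve)
open import Data.List using ([]; _∷_)
open import Data.Fin using (Fin; zero; suc; _≟_)
open import Data.Fin.Subset using (Subset; Nonempty; _∈_; _∉_; _⊆_; _∪_; _─_; ⁅_⁆; ∣_∣; ⊤; inside; outside)
open import Data.Fin.Subset.Properties using (_∈?_; x∈p∪q⁺; x∈p∪q⁻; x∈⁅x⁆; x≢y⇒x∉⁅y⁆; x∈p∧x∉q⇒x∈p─q; p─q⊆p; p⊆q⇒∣p∣≤∣q∣; ∣p∣≤n; ∣⊤∣≡n)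
open import Data.Product using (∃; _×_; _,_; proj₁)
open import Data.Sum using (_⊎_; inj₁; inj₂; [_,_]′; map₂; swap)
open import Data.Empty using (⊥; ⊥-elim)
open import Function using (_∘_)
open import Function.Bundles using (_⇔_; Equivalence)
open import Relation.Nullary using (¬_; Dec; yes; no; does)
open import Relation.Nullary.Decidable using (decidable-stable; ¬¬-excluded-middle)
open import Relation.Binary.PropositionalEquality using (_≡_; _≢_; refl; cong; trans; subst) renaming (sym to ≡-sym)

module SubsetFacts where
  open import Data.Vec using ([]; _∷_)
  open import Data.Vec.Base using (here; there)

  Disjointˢ : ∀ {n} → Subset n → Subset n → Set
  Disjointˢ p q = ∀ x → x ∈ p → x ∈ q → ⊥

  Covers : ∀ {n} → Subset n → Subset n → Subset n → Subset n → Set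
  Covers A B C D = ∀ x → x ∈ A ⊎ x ∈ B ⊎ x ∈ C ⊎ x ∈ D

  disjoint-tail : ∀ {n} {s t} {p q : Subset n} → Disjointˢ (s ∷ p) (t ∷ q) → Disjointˢ p q
  disjoint-tail d x x∈p x∈q = d (suc x) (there x∈p) (there x∈q)

  disjoint-∪ : ∀ {n} {p q r : Subset n} → Disjointˢ p q → Disjointˢ p r → Disjointˢ p (q ∪ r)
  disjoint-∪ {q = q} {r} dpq dpr x x∈p x∈q∪r = [ dpq x x∈p , dpr x x∈p ]′ (x∈p∪q⁻ q r x∈q∪r)

  x∈p─q⇒x∉q : ∀ {n} (p q : Subset n) {x} → x ∈ p ─ q → x ∉ q
  x∈p─q⇒x∉q (inside ∷ p) (outside ∷ q) here ()
  x∈p─q⇒x∉q (_ ∷ p) (_ ∷ q) (there x∈p─q) (there x∈q) = x∈p─q⇒x∉q p q x∈p─q x∈q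

  ∣p∪q∣≤∣p∣+∣q∣ : ∀ {n} (p q : Subset n) → ∣ p ∪ q ∣ ≤ ∣ p ∣ + ∣ q ∣
  ∣p∪q∣≤∣p∣+∣q∣ [] [] = z≤n
  ∣p∪q∣≤∣p∣+∣q∣ (outside ∷ p) (outside ∷ q) = ∣p∪q∣≤∣p∣+∣q∣ p q
  ∣p∪q∣≤∣p∣+∣q∣ (outside ∷ p) (inside ∷ q) =
    ≤-trans (s≤s (∣p∪q∣≤∣p∣+∣q∣ p q)) (≤-reflexive (≡-sym (+-suc ∣ p ∣ ∣ q ∣)))
  ∣p∪q∣≤∣p∣+∣q∣ (inside ∷ p) (outside ∷ q) = s≤s (∣p∪q∣≤∣p∣+∣q∣ p q)
  ∣p∪q∣≤∣p∣+∣q∣ (inside ∷ p) (inside ∷ q) =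
    s≤s (≤-trans (∣p∪q∣≤∣p∣+∣q∣ p q) (+-monoʳ-≤ ∣ p ∣ (n≤1+n ∣ q ∣)))

  ∣p∪q∣≡∣p∣+∣q∣ : ∀ {n} (p q : Subset n) → Disjointˢ p q → ∣ p ∪ q ∣ ≡ ∣ p ∣ + ∣ q ∣
  ∣p∪q∣≡∣p∣+∣q∣ [] [] d = refl
  ∣p∪q∣≡∣p∣+∣q∣ (outside ∷ p) (outside ∷ q) d = ∣p∪q∣≡∣p∣+∣q∣ p q (disjoint-tail d)
  ∣p∪q∣≡∣p∣+∣q∣ (outside ∷ p) (inside ∷ q) d =
    trans (cong suc (∣p∪q∣≡∣p∣+∣q∣ p q (disjoint-tail d))) (≡-sym (+-suc ∣ p ∣ ∣ q ∣))
  ∣p∪q∣≡∣p∣+∣q∣ (inside ∷ p) (outside ∷ q) d = cong suc (∣p∪q∣≡∣p∣+∣q∣ p q (disjoint-tail d))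
  ∣p∪q∣≡∣p∣+∣q∣ (inside ∷ p) (inside ∷ q) d = ⊥-elim (d zero here here)

  ∣p─q∣+∣q∣≤∣p∣ : ∀ {n} (p q : Subset n) → q ⊆ p → ∣ p ─ q ∣ + ∣ q ∣ ≤ ∣ p ∣
  ∣p─q∣+∣q∣≤∣p∣ p q q⊆p = begin
    ∣ p ─ q ∣ + ∣ q ∣  ≡⟨ ≡-sym (∣p∪q∣≡∣p∣+∣q∣ (p ─ q) q (λ x → x∈p─q⇒x∉q p q)) ⟩
    ∣ (p ─ q) ∪ q ∣    ≤⟨ p⊆q⇒∣p∣≤∣q∣ (λ m → [ p─q⊆p p q , q⊆p ]′ (x∈p∪q⁻ (p ─ q) q m)) ⟩
    ∣ p ∣              ∎
    where open ≤-Reasoning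

  cover-size : ∀ {n} (A B C D : Subset n) → Covers A B C D → n ≤ ∣ A ∣ + (∣ B ∣ + (∣ C ∣ + ∣ D ∣))
  cover-size {n} A B C D cov = begin
    n                                 ≡⟨ ≡-sym (∣⊤∣≡n n) ⟩
    ∣ ⊤ {n} ∣                         ≤⟨ p⊆q⇒∣p∣≤∣q∣ {p = ⊤} (λ {x} _ → in-union (cov x)) ⟩
    ∣ A ∪ (B ∪ (C ∪ D)) ∣             ≤⟨ ∣p∪q∣≤∣p∣+∣q∣ A _ ⟩
    ∣ A ∣ + ∣ B ∪ (C ∪ D) ∣           ≤⟨ +-monoʳ-≤ ∣ A ∣ (∣p∪q∣≤∣p∣+∣q∣ B _) ⟩
    ∣ A ∣ + (∣ B ∣ + ∣ C ∪ D ∣)       ≤⟨ +-monoʳ-≤ ∣ A ∣ (+-monoʳ-≤ ∣ B ∣ (∣p∪q∣≤∣p∣+∣q∣ C D)) ⟩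
    ∣ A ∣ + (∣ B ∣ + (∣ C ∣ + ∣ D ∣)) ∎
    where
    open ≤-Reasoning
    in-union : ∀ {x} → x ∈ A ⊎ x ∈ B ⊎ x ∈ C ⊎ x ∈ D → x ∈ A ∪ (B ∪ (C ∪ D))
    in-union m = x∈p∪q⁺ (map₂ (x∈p∪q⁺ ∘ map₂ x∈p∪q⁺) m)

  disjoint-size : ∀ {n} (A B C D : Subset n) →
    Disjointˢ A B → Disjointˢ A C → Disjointˢ A D → Disjointˢ B C → Disjointˢ B D → Disjointˢ C D →
    ∣ A ∣ + (∣ B ∣ + (∣ C ∣ + ∣ D ∣)) ≤ n
  disjoint-size {n} A B C D dAB dAC dAD dBC dBD dCD = begin
    ∣ A ∣ + (∣ B ∣ + (∣ C ∣ + ∣ D ∣)) ≡⟨ cong (λ m → ∣ A ∣ + (∣ B ∣ + m)) (≡-sym (∣p∪q∣≡∣p∣+∣q∣ C D dCD)) ⟩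
    ∣ A ∣ + (∣ B ∣ + ∣ C ∪ D ∣)       ≡⟨ cong (∣ A ∣ +_) (≡-sym (∣p∪q∣≡∣p∣+∣q∣ B _ (disjoint-∪ dBC dBD))) ⟩
    ∣ A ∣ + ∣ B ∪ (C ∪ D) ∣           ≡⟨ ≡-sym (∣p∪q∣≡∣p∣+∣q∣ A _ (disjoint-∪ dAB (disjoint-∪ dAC dAD))) ⟩
    ∣ A ∪ (B ∪ (C ∪ D)) ∣             ≤⟨ ∣p∣≤n (A ∪ (B ∪ (C ∪ D))) ⟩
    n                                 ∎
    where open ≤-Reasoning

  subsetOf : ∀ {n} {P : Fin n → Set} → (∀ x → Dec (P x)) → Subset n
  subsetOf {zero} P? = []
  subsetOf {suc n} P? = does (P? zero) ∷ subsetOf (λ x → P? (suc x))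

  ∈-subsetOf⁺ : ∀ {n} {P : Fin n → Set} (P? : ∀ x → Dec (P x)) {x} → P x → x ∈ subsetOf P?
  ∈-subsetOf⁺ P? {zero} Px with P? zero
  ... | yes _ = here
  ... | no ¬Px = ⊥-elim (¬Px Px)
  ∈-subsetOf⁺ P? {suc x} Px = there (∈-subsetOf⁺ (λ y → P? (suc y)) Px)

  ∈-subsetOf⁻ : ∀ {n} {P : Fin n → Set} (P? : ∀ x → Dec (P x)) {x} → x ∈ subsetOf P? → P x
  ∈-subsetOf⁻ P? {zero} x∈ with P? zero
  ∈-subsetOf⁻ P? {zero} here | yes Px = Px
  ∈-subsetOf⁻ P? {zero} () | no _
  ∈-subsetOf⁻ P? {suc x} (there x∈) = ∈-subsetOf⁻ (λ y → P? (suc y)) x∈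

open SubsetFacts

sum-with-small-part : ∀ {a b c d k s} → a ≤ k → b ≤ k → c ≤ k → d ≤ k →
  b ≤ s ⊎ c ≤ s ⊎ d ≤ s → a + (b + (c + d)) ≤ 3 * k + s
sum-with-small-part {k = k} {s} a≤k b≤k c≤k d≤k (inj₁ b≤s) =
  ≤-trans (+-mono-≤ a≤k (+-mono-≤ b≤s (+-mono-≤ c≤k d≤k))) (≤-reflexive (solve (k ∷ s ∷ [])))
sum-with-small-part {k = k} {s} a≤k b≤k c≤k d≤k (inj₂ (inj₁ c≤s)) =
  ≤-trans (+-mono-≤ a≤k (+-mono-≤ b≤k (+-mono-≤ c≤s d≤k))) (≤-reflexive (solve (k ∷ s ∷ [])))
sum-with-small-part {k = k} {s} a≤k b≤k c≤k d≤k (inj₂ (inj₂ d≤s)) =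
  ≤-trans (+-mono-≤ a≤k (+-mono-≤ b≤k (+-mono-≤ c≤k d≤s))) (≤-reflexive (solve (k ∷ s ∷ [])))

-- Small case: parts of sizes a = |V₃|, b = |V₄| with a + b ≤ 3k are incompatible with
-- 24k < 13b and 2b < 3a, which force 24(a + b) > 40b > 72k.
small-case-arithmetic : ∀ {a b k} → a + b ≤ 3 * k → 24 * k < 13 * b → 2 * b < 3 * a → ⊥
small-case-arithmetic {a} {b} {k} a+b≤3k k<b b<a = <-irrefl refl (begin-strict
  40 * b               ≡⟨ solve (b ∷ []) ⟩
  8 * (2 * b) + 24 * b <⟨ +-monoˡ-< (24 * b) (*-monoʳ-< 8 b<a) ⟩
  8 * (3 * a) + 24 * b ≡⟨ solve (a ∷ b ∷ []) ⟩
  24 * (a + b)         ≤⟨ *-monoʳ-≤ 24 a+b≤3k ⟩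
  24 * (3 * k)         ≡⟨ solve (k ∷ []) ⟩
  3 * (24 * k)         <⟨ *-monoʳ-< 3 k<b ⟩
  3 * (13 * b)         ≡⟨ solve (b ∷ []) ⟩
  39 * b               ≤⟨ *-monoˡ-≤ b (n≤1+n 39) ⟩
  40 * b               ∎)
  where open ≤-Reasoning

big-case-arithmetic : ∀ {a b v k w} → a + (b + v) ≤ k + w →
  24 * w ≤ 24 * (a + b) + 11 * v → 24 * k < 13 * v → ⊥
big-case-arithmetic {a} {b} {v} {k} {w} sizes w-small k<v = <-irrefl refl (begin-strict
  24 * (a + b) + 24 * v          ≡⟨ solve (a ∷ b ∷ v ∷ []) ⟩
  24 * (a + (b + v))             ≤⟨ *-monoʳ-≤ 24 sizes ⟩
  24 * (k + w)                   ≡⟨ *-distribˡ-+ 24 k w ⟩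
  24 * k + 24 * w                <⟨ +-mono-<-≤ k<v w-small ⟩
  13 * v + (24 * (a + b) + 11 * v) ≡⟨ solve (a ∷ b ∷ v ∷ []) ⟩
  24 * (a + b) + 24 * v          ∎)
  where open ≤-Reasoning

max₄-bounds : ∀ a b c d {k} → a ⊔ b ⊔ c ⊔ d ≡ k → a ≤ k × b ≤ k × c ≤ k × d ≤ k
max₄-bounds a b c d refl =
  ≤-trans (m≤m⊔n a b) (≤-trans (m≤m⊔n _ c) (m≤m⊔n _ d)) ,
  ≤-trans (m≤n⊔m a b) (≤-trans (m≤m⊔n _ c) (m≤m⊔n _ d)) ,
  ≤-trans (m≤n⊔m (a ⊔ b) c) (m≤m⊔n _ d) ,
  m≤n⊔m (a ⊔ b ⊔ c) d

bubble : {A B R : Set} → A ⊎ B ⊎ R → B ⊎ A ⊎ R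
bubble (inj₁ a) = inj₂ (inj₁ a)
bubble (inj₂ (inj₁ b)) = inj₁ b
bubble (inj₂ (inj₂ r)) = inj₂ (inj₂ r)

third-to-front : {A B C D : Set} → A ⊎ B ⊎ C ⊎ D → C ⊎ A ⊎ B ⊎ D
third-to-front = bubble ∘ map₂ bubble

fourth-to-front : {A B C D : Set} → A ⊎ B ⊎ C ⊎ D → D ⊎ A ⊎ B ⊎ C
fourth-to-front = bubble ∘ map₂ (bubble ∘ map₂ swap)

-- Any predicate on Fin n is decidable, in the double-negation sense.  This lets us
-- form the connected component of a vertex as a subset when proving a decidable goal.
¬¬-decidable : ∀ {n} (P : Fin n → Set) → ¬ ¬ (∀ x → Dec (P x))
¬¬-decidable {zero} P k = k (λ ())
¬¬-decidable {suc n} P k =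
  ¬¬-excluded-middle λ P0? → ¬¬-decidable (P ∘ suc) λ Ps? → k λ { zero → P0? ; (suc x) → Ps? x }

no-pull-bound : ∀ {n} {G : SimpleGraph n} {Vᵢ Vⱼ U : Subset n} → ¬ PullOn G Vᵢ Vⱼ →
  (∀ x → x ∈ U → x ∈ Vⱼ) → Nonempty U → Nonempty (Vⱼ ─ U) →
  Connected G U → Connected G (Vⱼ ─ U) → Adjacent G U Vᵢ → ∣ Vⱼ ∣ ≤ ∣ Vᵢ ∣ + ∣ U ∣
no-pull-bound no-pull U⊆Vⱼ U≠∅ rest≠∅ U-conn rest-conn U~Vᵢ =
  ≮⇒≥ λ small → no-pull (_ , U⊆Vⱼ , U≠∅ , rest≠∅ , U-conn , rest-conn , U~Vᵢ , small)

module Walks {n : ℕ} (G : SimpleGraph n) where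

  walk-start : ∀ {S x y} → Reach G S x y → x ∈ S
  walk-start (here x∈S) = x∈S
  walk-start (step x∈S _ _) = x∈S

  walk-end : ∀ {S x y} → Reach G S x y → y ∈ S
  walk-end (here y∈S) = y∈S
  walk-end (step _ _ r) = walk-end r

  walk-mono : ∀ {S T x y} → S ⊆ T → Reach G S x y → Reach G T x y
  walk-mono S⊆T (here x∈S) = here (S⊆T x∈S)
  walk-mono S⊆T (step x∈S e r) = step (S⊆T x∈S) e (walk-mono S⊆T r)

  walk-++ : ∀ {S x y z} → Reach G S x y → Reach G S y z → Reach G S x z
  walk-++ (here _) r′ = r′
  walk-++ (step x∈S e r) r′ = step x∈S e (walk-++ r r′)

  walk-reverse : ∀ {S x y} → Reach G S x y → Reach G S y x
  walk-reverse (here x∈S) = here x∈S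
  walk-reverse (step x∈S e r) = walk-++ (walk-reverse r) (step (walk-start r) (sym G e) (here x∈S))

  walk-exits : ∀ {S x y} (X : Subset n) → Reach G S x y → x ∈ X → y ∉ X →
               ∃ λ a → ∃ λ b → a ∈ X × b ∉ X × E G a b
  walk-exits X (here _) x∈X y∉X = ⊥-elim (y∉X x∈X)
  walk-exits X (step {x} {y} _ e r) x∈X z∉X with y ∈? X
  ... | yes y∈X = walk-exits X r y∈X z∉X
  ... | no y∉X = x , y , x∈X , y∉X , e

  connected-≐ : ∀ {S T} → S ⊆ T → T ⊆ S → Connected G S → Connected G T
  connected-≐ S⊆T T⊆S S-conn x y x∈T y∈T = walk-mono S⊆T (S-conn x y (T⊆S x∈T) (T⊆S y∈T))

  EdgeClosed : Subset n → (Fin n → Set) → Set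
  EdgeClosed S P = ∀ {y z} → y ∈ S → z ∈ S → E G y z → P y → P z

  spread : ∀ {Q q} → Connected G Q → (P : Fin n → Set) → EdgeClosed Q P →
           q ∈ Q → P q → ∀ {x} → x ∈ Q → P x
  spread {Q} {q} Q-conn P closed q∈Q Pq {x} x∈Q = along (Q-conn q x q∈Q x∈Q) Pq
    where
    along : ∀ {y z} → Reach G Q y z → P y → P z
    along (here _) Py = Py
    along (step y∈Q e r) Py = along r (closed y∈Q (walk-start r) e Py)

-- Its complement T - C is connected whenever T is, because every walk in T from
-- outside C to u avoids C; so if u has a neighbour in Vᵢ and Pull is not applicable
-- to (Vᵢ , T), then |C| ≤ |Vᵢ|.
module Component {n : ℕ} (G : SimpleGraph n) (T : Subset n) (u q : Fin n)
                 (reach? : ∀ x → Dec (Reach G (T ─ ⁅ u ⁆) q x)) where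
  open Walks G

  C : Subset n
  C = subsetOf reach?

  ∈C : ∀ {x} → Reach G (T ─ ⁅ u ⁆) q x → x ∈ C
  ∈C = ∈-subsetOf⁺ reach?

  C-reach : ∀ {x} → x ∈ C → Reach G (T ─ ⁅ u ⁆) q x
  C-reach = ∈-subsetOf⁻ reach?

  C⊆T : C ⊆ T
  C⊆T x∈C = p─q⊆p T ⁅ u ⁆ (walk-end (C-reach x∈C))

  u∉C : u ∉ C
  u∉C u∈C = x∈p─q⇒x∉q T ⁅ u ⁆ (walk-end (C-reach u∈C)) (x∈⁅x⁆ u)

  stay-in-C : ∀ {x y} → Reach G (T ─ ⁅ u ⁆) q x → Reach G (T ─ ⁅ u ⁆) x y → Reach G C x y
  stay-in-C q⇝x (here _) = here (∈C q⇝x)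
  stay-in-C q⇝x (step x∈ e r) =
    step (∈C q⇝x) e (stay-in-C (walk-++ q⇝x (step x∈ e (here (walk-start r)))) r)

  C-connected : Connected G C
  C-connected x y x∈C y∈C =
    stay-in-C (C-reach x∈C) (walk-++ (walk-reverse (C-reach x∈C)) (C-reach y∈C))

  -- A walk in G[T] from outside C to u never enters C before reaching u: a step from
  -- x ≠ u into C would put x itself in C.
  avoid-C : ∀ {x} → Reach G T x u → x ∉ C → Reach G (T ─ C) x u
  avoid-C (here x∈T) x∉C = here (x∈p∧x∉q⇒x∈p─q x∈T x∉C)
  avoid-C (step {x} {y} x∈T e r) x∉C with x ≟ u | y ∈? C
  ... | yes refl | _ = here (x∈p∧x∉q⇒x∈p─q x∈T x∉C)
  ... | no x≢u | yes y∈C = ⊥-elim (x∉C (∈C (walk-++ (C-reach y∈C)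
          (step (walk-end (C-reach y∈C)) (sym G e) (here (x∈p∧x∉q⇒x∈p─q x∈T (x≢y⇒x∉⁅y⁆ x≢u)))))))
  ... | no _ | no y∉C = step (x∈p∧x∉q⇒x∈p─q x∈T x∉C) e (avoid-C r y∉C)

  rest-connected : Connected G T → u ∈ T → Connected G (T ─ C)
  rest-connected T-conn u∈T x y x∈ y∈ = walk-++ (to-u x∈) (walk-reverse (to-u y∈))
    where
    to-u : ∀ {x} → x ∈ T ─ C → Reach G (T ─ C) x u
    to-u {x} x∈ = avoid-C (T-conn x u (p─q⊆p T C x∈) u∈T) (x∈p─q⇒x∉q T C x∈)

  C⊆T─rest : C ⊆ T ─ (T ─ C)
  C⊆T─rest x∈C = x∈p∧x∉q⇒x∈p─q (C⊆T x∈C) (λ x∈rest → x∈p─q⇒x∉q T C x∈rest x∈C)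

  T─rest⊆C : T ─ (T ─ C) ⊆ C
  T─rest⊆C {x} x∈ with x ∈? C
  ... | yes x∈C = x∈C
  ... | no x∉C = ⊥-elim (x∈p─q⇒x∉q T (T ─ C) x∈ (x∈p∧x∉q⇒x∈p─q (p─q⊆p T (T ─ C) x∈) x∉C))

  -- Pull could move T - C from T to Vᵢ unless |C| ≤ |Vᵢ|.
  component-bound : Connected G T → u ∈ T → q ∈ T ─ ⁅ u ⁆ → (Vᵢ : Subset n) → ¬ PullOn G Vᵢ T →
                    ∀ {z} → z ∈ Vᵢ → E G z u → ∣ C ∣ ≤ ∣ Vᵢ ∣
  component-bound T-conn u∈T q∈ Vᵢ no-pull {z} z∈Vᵢ e = +-cancelˡ-≤ (∣ T ─ C ∣) (∣ C ∣) (∣ Vᵢ ∣) (begin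
    ∣ T ─ C ∣ + ∣ C ∣  ≤⟨ ∣p─q∣+∣q∣≤∣p∣ T C C⊆T ⟩
    ∣ T ∣              ≤⟨ no-pull-bound no-pull (λ _ → p─q⊆p T C) (u , u∈rest) (q , q∈T─rest)
                            (rest-connected T-conn u∈T) (connected-≐ C⊆T─rest T─rest⊆C C-connected)
                            (u , z , u∈rest , z∈Vᵢ , sym G e) ⟩
    ∣ Vᵢ ∣ + ∣ T ─ C ∣ ≡⟨ +-comm (∣ Vᵢ ∣) (∣ T ─ C ∣) ⟩
    ∣ T ─ C ∣ + ∣ Vᵢ ∣ ∎)
    where
    open ≤-Reasoning
    u∈rest : u ∈ T ─ C
    u∈rest = x∈p∧x∉q⇒x∈p─q u∈T u∉C
    q∈T─rest : q ∈ T ─ (T ─ C)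
    q∈T─rest = C⊆T─rest (∈C (here q∈))

module Case1 {n : ℕ} (G : SimpleGraph n) (conn : ConnectedGraph G)
  (V₁ V₂ V₃ V₄ : Subset n) (v₁ : Fin n) (v₁∈V₁ : v₁ ∈ V₁) (V₄-conn : Connected G V₄)
  (d₁₂ : Disjoint G V₁ V₂) (d₁₃ : Disjoint G V₁ V₃) (d₁₄ : Disjoint G V₁ V₄)
  (d₂₃ : Disjoint G V₂ V₃) (d₂₄ : Disjoint G V₂ V₄) (d₃₄ : Disjoint G V₃ V₄)
  (cover : Covers V₁ V₂ V₃ V₄)
  (∣V₁∣≤∣V₂∣ : ∣ V₁ ∣ ≤ ∣ V₂ ∣) (no-pull₁₄ : ¬ PullOn G V₁ V₄) (no-pull₂₄ : ¬ PullOn G V₂ V₄)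
  (u : Fin n) (u∈V₄ : u ∈ V₄)
  (cut : ∀ x y → x ∈ V₁ ∪ V₂ → y ∈ V₃ ∪ V₄ → E G x y → y ≡ u)
  (W : Subset n)
  (W-def : ∀ w → w ∈ W ⇔ (w ∈ V₄ ─ ⁅ u ⁆ ×
     ∃ λ z → Reach G (V₄ ─ ⁅ u ⁆) w z × Adjacent G ⁅ z ⁆ V₃))
  where
  open Walks G

  S : Subset n
  S = V₄ ─ ⁅ u ⁆

  ∈S : ∀ {x} → x ∈ V₄ → x ≢ u → x ∈ S
  ∈S x∈V₄ x≢u = x∈p∧x∉q⇒x∈p─q x∈V₄ (x≢y⇒x∉⁅y⁆ x≢u)

  S⊆V₄ : S ⊆ V₄
  S⊆V₄ = p─q⊆p V₄ ⁅ u ⁆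

  S-avoids-u : ∀ {x} → x ∈ S → x ≢ u
  S-avoids-u x∈S refl = x∈p─q⇒x∉q V₄ ⁅ u ⁆ x∈S (x∈⁅x⁆ u)

  region : ∀ x → x ∈ V₁ ∪ V₂ ⊎ x ∈ V₃ ⊎ x ∈ V₄
  region x with cover x
  ... | inj₁ x∈V₁ = inj₁ (x∈p∪q⁺ (inj₁ x∈V₁))
  ... | inj₂ (inj₁ x∈V₂) = inj₁ (x∈p∪q⁺ (inj₂ x∈V₂))
  ... | inj₂ (inj₂ x∈V₃₄) = inj₂ x∈V₃₄

  -- u has a neighbour in V₁ ∪ V₂: G is connected and every edge leaving V₁ ∪ V₂ ends at u.
  attachment : ∃ λ z → z ∈ V₁ ∪ V₂ × E G z u
  attachment with walk-exits (V₁ ∪ V₂) (conn v₁ u) (x∈p∪q⁺ (inj₁ v₁∈V₁)) u∉V₁₂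
    where
    u∉V₁₂ : u ∉ V₁ ∪ V₂
    u∉V₁₂ u∈ = [ (λ u∈V₁ → d₁₄ u u∈V₁ u∈V₄) , (λ u∈V₂ → d₂₄ u u∈V₂ u∈V₄) ]′ (x∈p∪q⁻ V₁ V₂ u∈)
  ... | a , b , a∈V₁₂ , b∉V₁₂ , e with region b
  ...   | inj₁ b∈V₁₂ = ⊥-elim (b∉V₁₂ b∈V₁₂)
  ...   | inj₂ b∈V₃₄ = a , a∈V₁₂ , subst (E G a) (cut a b a∈V₁₂ (x∈p∪q⁺ b∈V₃₄) e) e

  W⊆S : W ⊆ S
  W⊆S {w} w∈W = proj₁ (Equivalence.to (W-def w) w∈W)

  W-attached : ∀ {z y} → z ∈ S → y ∈ V₃ → E G z y → z ∈ W
  W-attached {z} {y} z∈S y∈V₃ e = Equivalence.from (W-def z) (z∈S , z , here z∈S , z , y , x∈⁅x⁆ z , y∈V₃ , e)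

  W-step : ∀ {y z} → y ∈ W → z ∈ S → E G z y → z ∈ W
  W-step {y} {z} y∈W z∈S e with Equivalence.to (W-def y) y∈W
  ... | _ , t , y⇝t , t~V₃ = Equivalence.from (W-def z) (z∈S , t , step z∈S e y⇝t , t~V₃)

  -- A connected vertex set of G[V₄ - u] has at most |V₂| vertices: it lies in a
  -- component C of G[V₄ - u], and component-bound applies with the neighbour of u in
  -- V₁ ∪ V₂.  C is formed under double negation, which suffices for this decidable goal.
  piece-in-S-bound : (Q : Subset n) → Connected G Q → Nonempty Q → Q ⊆ S → ∣ Q ∣ ≤ ∣ V₂ ∣
  piece-in-S-bound Q Q-conn (q , q∈Q) Q⊆S = decidable-stable (∣ Q ∣ ≤? ∣ V₂ ∣)
    λ ¬bound → ¬¬-decidable (Reach G S q) λ reach? → ¬bound (bound reach?)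
    where
    bound : (∀ x → Dec (Reach G S q x)) → ∣ Q ∣ ≤ ∣ V₂ ∣
    bound reach? = ≤-trans (p⊆q⇒∣p∣≤∣q∣ Q⊆C) C-bound
      where
      open Component G V₄ u q reach?
      Q⊆C : Q ⊆ C
      Q⊆C {x} x∈Q = ∈C (walk-mono Q⊆S (Q-conn q x q∈Q x∈Q))
      C-bound : ∣ C ∣ ≤ ∣ V₂ ∣
      C-bound with attachment
      ... | z , z∈V₁₂ , e with x∈p∪q⁻ V₁ V₂ z∈V₁₂
      ...   | inj₁ z∈V₁ = ≤-trans (component-bound V₄-conn u∈V₄ (Q⊆S q∈Q) V₁ no-pull₁₄ z∈V₁ e) ∣V₁∣≤∣V₂∣
      ...   | inj₂ z∈V₂ = component-bound V₄-conn u∈V₄ (Q⊆S q∈Q) V₂ no-pull₂₄ z∈V₂ e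

  -- A connected set Q avoiding u cannot cross between the regions V₁ ∪ V₂, V₃ ∪ W and
  -- S - W of G - u, as each region is edge-closed in G[Q].
  module Trapped (Q : Subset n) (Q-conn : Connected G Q) (u∉Q : u ∉ Q) where

    avoids-u : ∀ {x} → x ∈ Q → x ≢ u
    avoids-u x∈Q refl = u∉Q x∈Q

    V₁₂-closed : EdgeClosed Q (_∈ V₁ ∪ V₂)
    V₁₂-closed {y} {z} _ z∈Q e y∈V₁₂ with region z
    ... | inj₁ z∈V₁₂ = z∈V₁₂
    ... | inj₂ z∈V₃₄ = ⊥-elim (avoids-u z∈Q (cut y z y∈V₁₂ (x∈p∪q⁺ z∈V₃₄) e))

    V₃W-closed : EdgeClosed Q (_∈ V₃ ∪ W)
    V₃W-closed {y} {z} y∈Q z∈Q e y∈V₃W with region z | x∈p∪q⁻ V₃ W y∈V₃W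
    ... | inj₁ z∈V₁₂ | y∈V₃⊎W =
      ⊥-elim (avoids-u y∈Q (cut z y z∈V₁₂ (x∈p∪q⁺ (map₂ (S⊆V₄ ∘ W⊆S) y∈V₃⊎W)) (sym G e)))
    ... | inj₂ (inj₁ z∈V₃) | _ = x∈p∪q⁺ (inj₁ z∈V₃)
    ... | inj₂ (inj₂ z∈V₄) | inj₁ y∈V₃ = x∈p∪q⁺ (inj₂ (W-attached (∈S z∈V₄ (avoids-u z∈Q)) y∈V₃ (sym G e)))
    ... | inj₂ (inj₂ z∈V₄) | inj₂ y∈W = x∈p∪q⁺ (inj₂ (W-step y∈W (∈S z∈V₄ (avoids-u z∈Q)) (sym G e)))

    S∖W-closed : EdgeClosed Q (λ x → x ∈ S × x ∉ W)
    S∖W-closed {y} {z} _ z∈Q e (y∈S , y∉W) with region z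
    ... | inj₁ z∈V₁₂ = ⊥-elim (S-avoids-u y∈S (cut z y z∈V₁₂ (x∈p∪q⁺ (inj₂ (S⊆V₄ y∈S))) (sym G e)))
    ... | inj₂ (inj₁ z∈V₃) = ⊥-elim (y∉W (W-attached y∈S z∈V₃ e))
    ... | inj₂ (inj₂ z∈V₄) = ∈S z∈V₄ (avoids-u z∈Q) , λ z∈W → y∉W (W-step z∈W y∈S e)

    piece-kind : Nonempty Q → Q ⊆ V₃ ∪ W ⊎ ∣ Q ∣ ≤ ∣ V₁ ∣ + ∣ V₂ ∣
    piece-kind (q , q∈Q) with region q
    ... | inj₁ q∈V₁₂ =
      inj₂ (≤-trans (p⊆q⇒∣p∣≤∣q∣ (spread Q-conn _ V₁₂-closed q∈Q q∈V₁₂)) (∣p∪q∣≤∣p∣+∣q∣ V₁ V₂))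
    ... | inj₂ (inj₁ q∈V₃) = inj₁ (spread Q-conn _ V₃W-closed q∈Q (x∈p∪q⁺ (inj₁ q∈V₃)))
    ... | inj₂ (inj₂ q∈V₄) with q ∈? W
    ...   | yes q∈W = inj₁ (spread Q-conn _ V₃W-closed q∈Q (x∈p∪q⁺ (inj₂ q∈W)))
    ...   | no q∉W = inj₂ (≤-trans (piece-in-S-bound Q Q-conn (q , q∈Q) Q⊆S) (m≤n+m _ _))
      where
      Q⊆S : Q ⊆ S
      Q⊆S x∈Q = proj₁ (spread Q-conn _ S∖W-closed q∈Q (∈S q∈V₄ (avoids-u q∈Q) , q∉W) x∈Q)

  open Trapped using (piece-kind)

  AvoidingPart : ℕ → Subset n → Set
  AvoidingPart k Q = Connected G Q × Nonempty Q × u ∉ Q × ∣ Q ∣ ≤ k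

  module Competitor (k : ℕ) (k-small : 24 * k < 13 * ∣ V₄ ∣) (V₃-large : 2 * ∣ V₄ ∣ < 3 * ∣ V₃ ∣)
    (W-small : 24 * ∣ W ∣ ≤ 24 * (∣ V₁ ∣ + ∣ V₂ ∣) + 11 * ∣ V₄ ∣) where

    -- With a part of size ≤ |V₁| + |V₂|, the four parts would give |V₃| + |V₄| ≤ 3k.
    small-part-impossible : (P Q₁ Q₂ Q₃ : Subset n) → Covers P Q₁ Q₂ Q₃ →
      ∣ P ∣ ≤ k → ∣ Q₁ ∣ ≤ k → ∣ Q₂ ∣ ≤ k → ∣ Q₃ ∣ ≤ k →
      ∣ Q₁ ∣ ≤ ∣ V₁ ∣ + ∣ V₂ ∣ ⊎ ∣ Q₂ ∣ ≤ ∣ V₁ ∣ + ∣ V₂ ∣ ⊎ ∣ Q₃ ∣ ≤ ∣ V₁ ∣ + ∣ V₂ ∣ → ⊥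
    small-part-impossible P Q₁ Q₂ Q₃ cov P≤k Q₁≤k Q₂≤k Q₃≤k small =
      small-case-arithmetic {∣ V₃ ∣} {∣ V₄ ∣} {k} (+-cancelˡ-≤ (∣ V₁ ∣ + ∣ V₂ ∣) _ _ (begin
        (∣ V₁ ∣ + ∣ V₂ ∣) + (∣ V₃ ∣ + ∣ V₄ ∣) ≡⟨ +-assoc (∣ V₁ ∣) (∣ V₂ ∣) _ ⟩
        ∣ V₁ ∣ + (∣ V₂ ∣ + (∣ V₃ ∣ + ∣ V₄ ∣)) ≤⟨ disjoint-size V₁ V₂ V₃ V₄ d₁₂ d₁₃ d₁₄ d₂₃ d₂₄ d₃₄ ⟩
        n                                     ≤⟨ cover-size P Q₁ Q₂ Q₃ cov ⟩
        ∣ P ∣ + (∣ Q₁ ∣ + (∣ Q₂ ∣ + ∣ Q₃ ∣))  ≤⟨ sum-with-small-part P≤k Q₁≤k Q₂≤k Q₃≤k small ⟩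
        3 * k + (∣ V₁ ∣ + ∣ V₂ ∣)             ≡⟨ +-comm (3 * k) _ ⟩
        (∣ V₁ ∣ + ∣ V₂ ∣) + 3 * k             ∎)) k-small V₃-large
      where open ≤-Reasoning

    -- If Q₁, Q₂, Q₃ lie in V₃ ∪ W, then V₁ ∪ V₂ ∪ V₄ ⊆ P ∪ W, which contradicts the
    -- bound on |W|.
    all-parts-in-V₃W-impossible : (P Q₁ Q₂ Q₃ : Subset n) → Covers P Q₁ Q₂ Q₃ → ∣ P ∣ ≤ k →
      Q₁ ⊆ V₃ ∪ W → Q₂ ⊆ V₃ ∪ W → Q₃ ⊆ V₃ ∪ W → ⊥
    all-parts-in-V₃W-impossible P Q₁ Q₂ Q₃ cov P≤k Q₁⊆ Q₂⊆ Q₃⊆ =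
      big-case-arithmetic {∣ V₁ ∣} {∣ V₂ ∣} {∣ V₄ ∣} {k} {∣ W ∣} (begin
        ∣ V₁ ∣ + (∣ V₂ ∣ + ∣ V₄ ∣) ≡⟨ cong (∣ V₁ ∣ +_) (≡-sym (∣p∪q∣≡∣p∣+∣q∣ V₂ V₄ d₂₄)) ⟩
        ∣ V₁ ∣ + ∣ V₂ ∪ V₄ ∣       ≡⟨ ≡-sym (∣p∪q∣≡∣p∣+∣q∣ V₁ _ (disjoint-∪ d₁₂ d₁₄)) ⟩
        ∣ V₁ ∪ (V₂ ∪ V₄) ∣         ≤⟨ p⊆q⇒∣p∣≤∣q∣ {p = V₁ ∪ (V₂ ∪ V₄)} into-P∪W ⟩
        ∣ P ∪ W ∣                  ≤⟨ ∣p∪q∣≤∣p∣+∣q∣ P W ⟩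
        ∣ P ∣ + ∣ W ∣              ≤⟨ +-monoˡ-≤ (∣ W ∣) P≤k ⟩
        k + ∣ W ∣                  ∎) W-small k-small
      where
      open ≤-Reasoning
      in-P : ∀ {x} → x ∉ V₃ ∪ W → x ∈ P
      in-P {x} x∉ with cov x
      ... | inj₁ x∈P = x∈P
      ... | inj₂ (inj₁ x∈Q₁) = ⊥-elim (x∉ (Q₁⊆ x∈Q₁))
      ... | inj₂ (inj₂ (inj₁ x∈Q₂)) = ⊥-elim (x∉ (Q₂⊆ x∈Q₂))
      ... | inj₂ (inj₂ (inj₂ x∈Q₃)) = ⊥-elim (x∉ (Q₃⊆ x∈Q₃))
      not-in-V₃ : ∀ {x} → x ∈ V₁ ∪ (V₂ ∪ V₄) → x ∉ V₃
      not-in-V₃ {x} x∈ x∈V₃ with x∈p∪q⁻ V₁ (V₂ ∪ V₄) x∈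
      ... | inj₁ x∈V₁ = d₁₃ x x∈V₁ x∈V₃
      ... | inj₂ x∈V₂₄ = [ (λ x∈V₂ → d₂₃ x x∈V₂ x∈V₃) , d₃₄ x x∈V₃ ]′ (x∈p∪q⁻ V₂ V₄ x∈V₂₄)
      into-P∪W : V₁ ∪ (V₂ ∪ V₄) ⊆ P ∪ W
      into-P∪W {x} x∈ with x ∈? W
      ... | yes x∈W = x∈p∪q⁺ (inj₂ x∈W)
      ... | no x∉W = x∈p∪q⁺ (inj₁ (in-P λ x∈V₃W → [ not-in-V₃ x∈ , x∉W ]′ (x∈p∪q⁻ V₃ W x∈V₃W)))

    no-cover : (P Q₁ Q₂ Q₃ : Subset n) → Covers P Q₁ Q₂ Q₃ → ∣ P ∣ ≤ k →
      AvoidingPart k Q₁ → AvoidingPart k Q₂ → AvoidingPart k Q₃ → ⊥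
    no-cover P Q₁ Q₂ Q₃ cov P≤k (c₁ , ne₁ , u∉₁ , Q₁≤k) (c₂ , ne₂ , u∉₂ , Q₂≤k) (c₃ , ne₃ , u∉₃ , Q₃≤k)
      with piece-kind Q₁ c₁ u∉₁ ne₁ | piece-kind Q₂ c₂ u∉₂ ne₂ | piece-kind Q₃ c₃ u∉₃ ne₃
    ... | inj₁ Q₁⊆ | inj₁ Q₂⊆ | inj₁ Q₃⊆ = all-parts-in-V₃W-impossible P Q₁ Q₂ Q₃ cov P≤k Q₁⊆ Q₂⊆ Q₃⊆
    ... | inj₂ small | _ | _ = small-part-impossible P Q₁ Q₂ Q₃ cov P≤k Q₁≤k Q₂≤k Q₃≤k (inj₁ small)
    ... | inj₁ _ | inj₂ small | _ = small-part-impossible P Q₁ Q₂ Q₃ cov P≤k Q₁≤k Q₂≤k Q₃≤k (inj₂ (inj₁ small))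
    ... | inj₁ _ | inj₁ _ | inj₂ small = small-part-impossible P Q₁ Q₂ Q₃ cov P≤k Q₁≤k Q₂≤k Q₃≤k (inj₂ (inj₂ small))

    no-tetrapartition : (A B C D : Subset n) → FeasibleTetra G A B C D → maxPart G A B C D ≡ k → ⊥
    no-tetrapartition A B C D ((neA , neB , neC , neD) , (cA , cB , cC , cD) ,
                               (dAB , dAC , dAD , dBC , dBD , dCD) , cov) max≡k
      with max₄-bounds (∣ A ∣) (∣ B ∣) (∣ C ∣) (∣ D ∣) max≡k | cov u
    ... | bA , bB , bC , bD | inj₁ u∈A =
      no-cover A B C D cov bA
        (cB , neB , dAB u u∈A , bB) (cC , neC , dAC u u∈A , bC) (cD , neD , dAD u u∈A , bD)
    ... | bA , bB , bC , bD | inj₂ (inj₁ u∈B) =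
      no-cover B A C D (bubble ∘ cov) bB
        (cA , neA , (λ u∈A → dAB u u∈A u∈B) , bA) (cC , neC , dBC u u∈B , bC) (cD , neD , dBD u u∈B , bD)
    ... | bA , bB , bC , bD | inj₂ (inj₂ (inj₁ u∈C)) =
      no-cover C A B D (third-to-front ∘ cov) bC
        (cA , neA , (λ u∈A → dAC u u∈A u∈C) , bA) (cB , neB , (λ u∈B → dBC u u∈B u∈C) , bB)
        (cD , neD , dCD u u∈C , bD)
    ... | bA , bB , bC , bD | inj₂ (inj₂ (inj₂ u∈D)) =
      no-cover D A B C (fourth-to-front ∘ cov) bD
        (cA , neA , (λ u∈A → dAD u u∈A u∈D) , bA) (cB , neB , (λ u∈B → dBD u u∈B u∈D) , bB)
        (cC , neC , (λ u∈C → dCD u u∈C u∈D) , bC)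

  opt-bound : (k : ℕ) → 2 * ∣ V₄ ∣ < 3 * ∣ V₃ ∣ →
    24 * ∣ W ∣ ≤ 24 * (∣ V₁ ∣ + ∣ V₂ ∣) + 11 * ∣ V₄ ∣ → IsOPT G k → 13 * ∣ V₄ ∣ ≤ 24 * k
  opt-bound k V₃-large W-small ((A , B , C , D , feasible , max≡k) , _) with 13 * ∣ V₄ ∣ ≤? 24 * k
  ... | yes bound = bound
  ... | no ¬bound =
    ⊥-elim (Competitor.no-tetrapartition k (≰⇒> ¬bound) V₃-large W-small A B C D feasible max≡k)

-- Of the hypotheses, the argument uses the connectivity of G and of the parts, their
-- disjointness and covering, |V₁| ≤ |V₂|, the absence of Pulls from V₄ to V₁ and to V₂,
-- |V₄| < n/2 < 3|V₃|/2, the Case 1 structure around u and the bound on |V'₄|.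
theorem3 : (n : ℕ) (G : SimpleGraph n) → ConnectedGraph G →
    (V₁ V₂ V₃ V₄ : Subset n) → FeasibleTetra G V₁ V₂ V₃ V₄ →
    ∣ V₁ ∣ ≤ ∣ V₂ ∣ → ∣ V₂ ∣ ≤ ∣ V₃ ∣ → ∣ V₃ ∣ ≤ ∣ V₄ ∣ →
    2 * n < 5 * ∣ V₄ ∣ →
    ¬ MergeOn G V₁ V₂ V₄ → ¬ MergeOn G V₂ V₁ V₄ →
    ¬ MergeOn G V₁ V₃ V₄ → ¬ MergeOn G V₃ V₁ V₄ →
    ¬ MergeOn G V₂ V₃ V₄ → ¬ MergeOn G V₃ V₂ V₄ →
    ¬ PullOn G V₁ V₃ → ¬ PullOn G V₁ V₄ → ¬ PullOn G V₂ V₃ →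
    ¬ PullOn G V₂ V₄ → ¬ PullOn G V₃ V₄ →
    ∣ V₄ ∣ ≤ ∣ V₂ ∣ + ∣ V₃ ∣ →
    2 * ∣ V₄ ∣ < n →
    6 * ∣ V₂ ∣ < ∣ V₄ ∣ →
    2 * ∣ V₄ ∣ < n →
    n < 3 * ∣ V₃ ∣ →
    ¬ Adjacent G V₁ V₃ → ¬ Adjacent G V₂ V₃ →
    (u : Fin n) → u ∈ V₄ →
    (∀ x y → x ∈ V₁ ∪ V₂ → y ∈ V₃ ∪ V₄ → E G x y → y ≡ u) →
    (W : Subset n) →
    (∀ w → w ∈ W ⇔ (w ∈ V₄ ─ ⁅ u ⁆ ×
       ∃ λ z → Reach G (V₄ ─ ⁅ u ⁆) w z × Adjacent G ⁅ z ⁆ V₃)) →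
    24 * ∣ W ∣ ≤ 24 * (∣ V₁ ∣ + ∣ V₂ ∣) + 11 * ∣ V₄ ∣ →
    (k : ℕ) → IsOPT G k →
    13 * ∣ V₄ ∣ ≤ 24 * k
theorem3 n G conn V₁ V₂ V₃ V₄
  (((v₁ , v₁∈V₁) , _) , (_ , _ , _ , V₄-conn) , (d₁₂ , d₁₃ , d₁₄ , d₂₃ , d₂₄ , d₃₄) , cover)
  ∣V₁∣≤∣V₂∣ _ _ _ _ _ _ _ _ _ _ no-pull₁₄ _ no-pull₂₄ _ _ 2∣V₄∣<n _ _ n<3∣V₃∣ _ _
  u u∈V₄ cut W W-def W-small k opt =
  Case1.opt-bound G conn V₁ V₂ V₃ V₄ v₁ v₁∈V₁ V₄-conn d₁₂ d₁₃ d₁₄ d₂₃ d₂₄ d₃₄ cover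
    ∣V₁∣≤∣V₂∣ no-pull₁₄ no-pull₂₄ u u∈V₄ cut W W-def
    k (<-trans 2∣V₄∣<n n<3∣V₃∣) W-small opt
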